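{- Let $\mathcal L$ be a finite first-order language, let $\mathcal A$ be any $\mathcal L$-structure, let $k\in\omega$, and let $\tau$ be an $\mathcal L$-formula of rank $k$. Then for every valuation in $\mathcal A$ of the free variables of $\tau$, the formula $\tau\wedge\neg\tau$ is not $(k+1)$-fulfillable in $\mathcal A$; that is, there is no sequence $\sigma=\langle A_0,\dots,A_{k+1}\rangle$ of nonempty subsets of the domain of $\mathcal A$ which fulfils $\tau\wedge\neg\tau$ (under that valuation).
   Context: Rank: a formula is of rank $0$ if it is quantifier-free; a Boolean combination of formulae of rank at most $k$ has rank $k$; and $\mathsf Q x\,\theta$ ($\mathsf Q\in\{\exists,\forall\}$) has rank $k+1$ if $\theta$ has rank $k$. Fulfilment. Let $\sigma=\langle A_0,\dots,A_n\rangle$ be a finite sequence of nonempty subsets of the domain $A$ of $\mathcal A$, and let $i,j$ range over $\{0,\dots,n-1\}$. For each formula $\varphi$ define $\varphi_i=\varphi^\sigma_i$ inductively: if $\theta$ is atomic, $\theta_i=\theta$ and $(\neg\theta)_i=\neg\theta$; $(\exists x\,\theta)_i=\exists x\in A_{i+1}\,\theta_i$; $(\forall x\,\theta)_i=\forall j\ge i\,\forall x\in A_j\,\theta_j$ ($j$ a new variable ranging over $\{0,\dots,n-1\}$); $(\neg\forall x\,\theta)_i=(\exists x\,\neg\theta)_i$ and $(\neg\exists x\,\theta)_i=(\forall x\,\neg\theta)_i$; otherwise $\theta_i$ is obtained from $\theta$ by replacing each positive occurrence of a maximal subformula $\psi$ that is atomic or begins with a quantifier by $\psi_i$ and each negative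 occurrence by $\neg(\neg\psi)_i$. The sequence $\sigma$ is increasing if $A_i\subseteq A_{i+1}$ for all $i<n$, and closed if $f''A_i\subseteq A_{i+1}$ for every function symbol $f$ of $\mathcal L$ and all $i<n$ and every constant of $\mathcal L$ lies in $A_0$. $\sigma$ fulfils $\varphi(\vec a)$ (for a valuation $\vec a$ in $A$) if $\mathcal A\models(\varphi(\vec a))^\sigma_0$ and $\sigma$ is increasing and closed; by convention a closed sequence of length one fulfils every formula. A formula is $m$-fulfillable if some sequence $\langle A_0,\dots,A_m\rangle$ (i.e. with $m+1$ terms) fulfils it. -}

module Defs where

open import Level using (0ℓ)
open import Data.Nat using (ℕ; zero; suc; _≤_; _≟_)
open import Data.Fin using (Fin; inject₁) renaming (_≤_ to _≤ᶠ_; zero to fzero; suc to fsuc)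
open import Data.Product using (Σ; ∃; _×_; _,_)
open import Data.Sum using (_⊎_)
open import Data.Unit using (⊤)
open import Data.Empty using (⊥)
open import Relation.Nullary using (¬_; yes; no)
open import Relation.Unary using (Pred; _∈_)
open import Relation.Binary.PropositionalEquality using (_≡_)

-- A finite first-order language: finitely many function symbols
-- (constants = 0-ary function symbols) and finitely many relation
-- symbols, each with an arity.  Equality is always available.

record Language : Set where
  field
    nFun     : ℕ
    funArity : Fin nFun → ℕ
    nRel     : ℕ
    relArity : Fin nRel → ℕ
open Language public

record Structure (L : Language) : Set₁ where
  field
    Carrier : Set
    funI    : (f : Fin (nFun L)) → (Fin (funArity L f) → Carrier) → Carrier
    relI    : (r : Fin (nRel L)) → (Fin (relArity L r) → Carrier) → Set
open Structure public

Var : Set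
Var = ℕ

data Term (L : Language) : Set where
  var : Var → Term L
  app : (f : Fin (nFun L)) → (Fin (funArity L f) → Term L) → Term L

data Formula (L : Language) : Set where
  rel  : (r : Fin (nRel L)) → (Fin (relArity L r) → Term L) → Formula L
  eq   : Term L → Term L → Formula L
  neg  : Formula L → Formula L
  and  : Formula L → Formula L → Formula L
  or   : Formula L → Formula L → Formula L
  imp  : Formula L → Formula L → Formula L
  all  : Var → Formula L → Formula L
  ex   : Var → Formula L → Formula L

data QF {L : Language} : Formula L → Set where
  rel : ∀ r ts → QF (rel r ts)
  eq  : ∀ t u → QF (eq t u)
  neg : ∀ {φ} → QF φ → QF (neg φ)
  and : ∀ {φ ψ} → QF φ → QF ψ → QF (and φ ψ)
  or  : ∀ {φ ψ} → QF φ → QF ψ → QF (or φ ψ)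
  imp : ∀ {φ ψ} → QF φ → QF ψ → QF (imp φ ψ)

-- HasRank k φ : "φ has rank k".
-- A Boolean combination of formulae of rank at most k has rank k
-- (the trivial combination consisting of a single formula included).
data HasRank {L : Language} : ℕ → Formula L → Set where
  qf   : ∀ {φ} → QF φ → HasRank 0 φ
  self : ∀ {j k φ} → HasRank j φ → j ≤ k → HasRank k φ
  neg  : ∀ {j k φ} → HasRank j φ → j ≤ k → HasRank k (neg φ)
  and  : ∀ {j j' k φ ψ} → HasRank j φ → HasRank j' ψ → j ≤ k → j' ≤ k → HasRank k (and φ ψ)
  or   : ∀ {j j' k φ ψ} → HasRank j φ → HasRank j' ψ → j ≤ k → j' ≤ k → HasRank k (or φ ψ)
  imp  : ∀ {j j' k φ ψ} → HasRank j φ → HasRank j' ψ → j ≤ k → j' ≤ k → HasRank k (imp φ ψ)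
  all  : ∀ {k x θ} → HasRank k θ → HasRank (suc k) (all x θ)
  ex   : ∀ {k x θ} → HasRank k θ → HasRank (suc k) (ex x θ)

module _ {L : Language} (𝒜 : Structure L) where

  private D = Carrier 𝒜

  Env : Set
  Env = Var → D

  _[_↦_] : Env → Var → D → Env
  (ρ [ x ↦ a ]) y with y ≟ x
  ... | yes _ = a
  ... | no  _ = ρ y

  evalT : Env → Term L → D
  evalT ρ (var x)    = ρ x
  evalT ρ (app f ts) = funI 𝒜 f (λ i → evalT ρ (ts i))

  -- truth of atomic formulae (only used on atomic formulae)
  Atom : Env → Formula L → Set
  Atom ρ (rel r ts) = relI 𝒜 r (λ i → evalT ρ (ts i))
  Atom ρ (eq t u)   = evalT ρ t ≡ evalT ρ u
  Atom ρ _          = ⊤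

  Seq : ℕ → Set₁
  Seq n = Fin (suc n) → Pred D 0ℓ

  Nonempty : Pred D 0ℓ → Set
  Nonempty P = Σ D λ a → a ∈ P

  -- Indices i, j range over {0,…,n-1} = Fin n; A_i is σ (inject₁ i),
  -- A_{i+1} is σ (fsuc i).
  --   tr  φ i ρ  : 𝒜 ⊨ (φ)_i [ρ]
  --   trN φ i ρ  : 𝒜 ⊨ (¬φ)_i [ρ]
  --   bP  φ i ρ  : value of a maximal-subformula replacement of φ
  --                occurring positively (Boolean skeleton kept)
  --   bN  φ i ρ  : same, φ occurring negatively (each maximal ψ that is
  --                atomic or quantified is replaced by ¬(¬ψ)_i)
  module Translation {n : ℕ} (σ : Seq n) where
    A_ : Fin n → Pred D 0ℓ
    A_ j = σ (inject₁ j)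

    A₊ : Fin n → Pred D 0ℓ
    A₊ i = σ (fsuc i)

    mutual
      tr : Formula L → Fin n → Env → Set
      tr (rel r ts) i ρ = Atom ρ (rel r ts)
      tr (eq t u)   i ρ = Atom ρ (eq t u)
      tr (neg φ)    i ρ = trN φ i ρ
      tr (and φ ψ)  i ρ = bP φ i ρ × bP ψ i ρ
      tr (or φ ψ)   i ρ = bP φ i ρ ⊎ bP ψ i ρ
      tr (imp φ ψ)  i ρ = bN φ i ρ → bP ψ i ρ
      tr (all x θ)  i ρ = (j : Fin n) → i ≤ᶠ j → (a : D) → a ∈ A_ j → tr θ j (ρ [ x ↦ a ])
      tr (ex x θ)   i ρ = Σ D λ a → a ∈ A₊ i × tr θ i (ρ [ x ↦ a ])

      trN : Formula L → Fin n → Env → Set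
      trN (rel r ts) i ρ = ¬ Atom ρ (rel r ts)
      trN (eq t u)   i ρ = ¬ Atom ρ (eq t u)
      -- (¬∀xθ)_i = (∃x¬θ)_i = ∃x∈A_{i+1} (¬θ)_i
      trN (all x θ)  i ρ = Σ D λ a → a ∈ A₊ i × trN θ i (ρ [ x ↦ a ])
      -- (¬∃xθ)_i = (∀x¬θ)_i = ∀j≥i ∀x∈A_j (¬θ)_j
      trN (ex x θ)   i ρ = (j : Fin n) → i ≤ᶠ j → (a : D) → a ∈ A_ j → trN θ j (ρ [ x ↦ a ])
      -- otherwise ¬φ is a Boolean combination: replace maximal subformulae
      trN (neg φ)    i ρ = ¬ (¬ bP φ i ρ)
      trN (and φ ψ)  i ρ = ¬ (bN φ i ρ × bN ψ i ρ)
      trN (or φ ψ)   i ρ = ¬ (bN φ i ρ ⊎ bN ψ i ρ)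
      trN (imp φ ψ)  i ρ = ¬ (bP φ i ρ → bN ψ i ρ)

      bP : Formula L → Fin n → Env → Set
      bP (rel r ts) i ρ = Atom ρ (rel r ts)
      bP (eq t u)   i ρ = Atom ρ (eq t u)
      bP (neg φ)    i ρ = ¬ bN φ i ρ
      bP (and φ ψ)  i ρ = bP φ i ρ × bP ψ i ρ
      bP (or φ ψ)   i ρ = bP φ i ρ ⊎ bP ψ i ρ
      bP (imp φ ψ)  i ρ = bN φ i ρ → bP ψ i ρ
      bP (all x θ)  i ρ = (j : Fin n) → i ≤ᶠ j → (a : D) → a ∈ A_ j → tr θ j (ρ [ x ↦ a ])
      bP (ex x θ)   i ρ = Σ D λ a → a ∈ A₊ i × tr θ i (ρ [ x ↦ a ])

      bN : Formula L → Fin n → Env → Set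
      bN (rel r ts) i ρ = ¬ ¬ Atom ρ (rel r ts)
      bN (eq t u)   i ρ = ¬ ¬ Atom ρ (eq t u)
      bN (neg φ)    i ρ = ¬ bP φ i ρ
      bN (and φ ψ)  i ρ = bN φ i ρ × bN ψ i ρ
      bN (or φ ψ)   i ρ = bN φ i ρ ⊎ bN ψ i ρ
      bN (imp φ ψ)  i ρ = bP φ i ρ → bN ψ i ρ
      bN (all x θ)  i ρ = ¬ (Σ D λ a → a ∈ A₊ i × trN θ i (ρ [ x ↦ a ]))
      bN (ex x θ)   i ρ = ¬ ((j : Fin n) → i ≤ᶠ j → (a : D) → a ∈ A_ j → trN θ j (ρ [ x ↦ a ]))

  Increasing : {n : ℕ} → Seq n → Set
  Increasing {n} σ = (i : Fin n) → ∀ {a} → a ∈ σ (inject₁ i) → a ∈ σ (fsuc i)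

  Closed : {n : ℕ} → Seq n → Set
  Closed {n} σ =
      ((f : Fin (nFun L)) → funArity L f ≡ 0 → (args : Fin (funArity L f) → D) → funI 𝒜 f args ∈ σ fzero)
    × ((f : Fin (nFun L)) (i : Fin n) (args : Fin (funArity L f) → D) →
         (∀ m → args m ∈ σ (inject₁ i)) → funI 𝒜 f args ∈ σ (fsuc i))

  Fulfils : {n : ℕ} → Seq n → Formula L → Env → Set
  Fulfils {zero}  σ φ ρ = Closed σ
  Fulfils {suc m} σ φ ρ = Translation.tr σ φ fzero ρ × Increasing σ × Closed σ

  Fulfillable : ℕ → Formula L → Env → Set₁
  Fulfillable m φ ρ = Σ (Seq m) λ σ → ((i : Fin (suc m)) → Nonempty (σ i)) × Fulfils σ φ ρ

module Submission where

-- A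
-- positive reading of a formula at index p refutes its negative reading at
-- index q as long as both p and q lie at least its quantifier depth below the
-- last index: at a quantifier, the two witnesses are moved by monotonicity of
-- σ to a common later index, while the depth drops by one.  A formula of rank
-- k has quantifier depth at most k, and ⟨A_0,…,A_{k+1}⟩ has indices 0,…,k, so
-- from index 0 there is exactly enough room.

open import Defs
open import Data.Nat using (ℕ; suc; _≤_; _<_; _+_; _⊔_; z≤n; s≤s)
open import Data.Nat.Properties
  using (≤-trans; ≤-<-trans; +-monoʳ-≤; +-suc; +-distribʳ-⊔; ⊔-lub; m≤m⊔n; m≤n⊔m; m≤m+n; n≤1+n)
open import Data.Fin using (Fin; toℕ; fromℕ<) renaming (_≤_ to _≤ᶠ_; _<_ to _<ᶠ_; zero to fzero)
open import Data.Fin.Induction using (<-weakInduction-startingFrom)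
open import Data.Fin.Properties using (toℕ-inject₁; toℕ-fromℕ<)
open import Data.Product using (∃-syntax; _×_; _,_)
open import Data.Sum using (inj₁; inj₂)
open import Relation.Nullary using (¬_)
open import Relation.Unary using (_∈_; _⊆_)
open import Relation.Binary.PropositionalEquality using (_≡_; refl; sym; subst)

module _ {L : Language} where

  quantifierDepth : Formula L → ℕ
  quantifierDepth (rel r ts) = 0
  quantifierDepth (eq t u)   = 0
  quantifierDepth (neg φ)    = quantifierDepth φ
  quantifierDepth (and φ ψ)  = quantifierDepth φ ⊔ quantifierDepth ψ
  quantifierDepth (or φ ψ)   = quantifierDepth φ ⊔ quantifierDepth ψ
  quantifierDepth (imp φ ψ)  = quantifierDepth φ ⊔ quantifierDepth ψ
  quantifierDepth (all x θ)  = suc (quantifierDepth θ)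
  quantifierDepth (ex x θ)   = suc (quantifierDepth θ)

  QF⇒quantifierDepth≡0 : ∀ {φ : Formula L} → QF φ → quantifierDepth φ ≡ 0
  QF⇒quantifierDepth≡0 (rel r ts) = refl
  QF⇒quantifierDepth≡0 (eq t u)   = refl
  QF⇒quantifierDepth≡0 (neg q)    = QF⇒quantifierDepth≡0 q
  QF⇒quantifierDepth≡0 (and q q') rewrite QF⇒quantifierDepth≡0 q | QF⇒quantifierDepth≡0 q' = refl
  QF⇒quantifierDepth≡0 (or q q')  rewrite QF⇒quantifierDepth≡0 q | QF⇒quantifierDepth≡0 q' = refl
  QF⇒quantifierDepth≡0 (imp q q') rewrite QF⇒quantifierDepth≡0 q | QF⇒quantifierDepth≡0 q' = refl

  HasRank⇒quantifierDepth≤ : ∀ {k} {φ : Formula L} → HasRank k φ → quantifierDepth φ ≤ k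
  HasRank⇒quantifierDepth≤ (qf q) rewrite QF⇒quantifierDepth≡0 q = z≤n
  HasRank⇒quantifierDepth≤ (self h j≤k) = ≤-trans (HasRank⇒quantifierDepth≤ h) j≤k
  HasRank⇒quantifierDepth≤ (neg h j≤k) = ≤-trans (HasRank⇒quantifierDepth≤ h) j≤k
  HasRank⇒quantifierDepth≤ (and h h' a b) =
    ⊔-lub (≤-trans (HasRank⇒quantifierDepth≤ h) a) (≤-trans (HasRank⇒quantifierDepth≤ h') b)
  HasRank⇒quantifierDepth≤ (or h h' a b) =
    ⊔-lub (≤-trans (HasRank⇒quantifierDepth≤ h) a) (≤-trans (HasRank⇒quantifierDepth≤ h') b)
  HasRank⇒quantifierDepth≤ (imp h h' a b) =
    ⊔-lub (≤-trans (HasRank⇒quantifierDepth≤ h) a) (≤-trans (HasRank⇒quantifierDepth≤ h') b)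
  HasRank⇒quantifierDepth≤ (all h) = s≤s (HasRank⇒quantifierDepth≤ h)
  HasRank⇒quantifierDepth≤ (ex h) = s≤s (HasRank⇒quantifierDepth≤ h)

-- A record rather than a synonym for toℕ i + d < n, so that d and i can be
-- inferred.
record Fits {n} (d : ℕ) (i : Fin n) : Set where
  constructor fits
  field room : toℕ i + d < n

Fits-⊔ˡ : ∀ {n} {a b} {i : Fin n} → Fits (a ⊔ b) i → Fits a i
Fits-⊔ˡ {a = a} {b} {i} (fits r) = fits (≤-<-trans (+-monoʳ-≤ (toℕ i) (m≤m⊔n a b)) r)

Fits-⊔ʳ : ∀ {n} {a b} {i : Fin n} → Fits (a ⊔ b) i → Fits b i
Fits-⊔ʳ {a = a} {b} {i} (fits r) = fits (≤-<-trans (+-monoʳ-≤ (toℕ i) (m≤n⊔m a b)) r)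

Fits-suc⇒Fits : ∀ {n} {d} {i : Fin n} → Fits (suc d) i → Fits d i
Fits-suc⇒Fits {d = d} {i} (fits r) = fits (≤-<-trans (+-monoʳ-≤ (toℕ i) (n≤1+n d)) r)

Fits-common-successor : ∀ {n} d (p q : Fin n) → Fits (suc d) p → Fits (suc d) q →
                        ∃[ j ] p ≤ᶠ j × q <ᶠ j × Fits d j
Fits-common-successor {n} d p q (fits p-room) (fits q-room) =
  j , subst (toℕ p ≤_) (sym j≡m) (m≤m⊔n _ _) , subst (suc (toℕ q) ≤_) (sym j≡m) (m≤n⊔m _ _)
    , fits (subst (λ m → m + d < n) (sym j≡m) m-room)
  where
  m = toℕ p ⊔ suc (toℕ q)
  m-room : m + d < n
  m-room = subst (_< n) (sym (+-distribʳ-⊔ d (toℕ p) (suc (toℕ q))))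
             (⊔-lub (≤-<-trans (+-monoʳ-≤ (toℕ p) (n≤1+n d)) p-room)
                    (subst (_< n) (+-suc (toℕ q) d) q-room))
  m<n = ≤-<-trans (m≤m+n m d) m-room
  j = fromℕ< m<n
  j≡m = toℕ-fromℕ< m<n

module _ {L : Language} (𝒜 : Structure L) {n : ℕ} (σ : Seq 𝒜 n) (increasing : Increasing 𝒜 σ) where
  open Translation 𝒜 σ

  Increasing⇒monotone : ∀ {x y} → x ≤ᶠ y → σ x ⊆ σ y
  Increasing⇒monotone x≤y a∈σx =
    <-weakInduction-startingFrom (λ z → _ ∈ σ z) a∈σx (λ j → increasing j) x≤y

  A₊⊆A : ∀ {q j} → q <ᶠ j → A₊ q ⊆ A_ j
  A₊⊆A {q} {j} q<j = Increasing⇒monotone (subst (suc (toℕ q) ≤_) (sym (toℕ-inject₁ j)) q<j)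

  trN⇒¬bN : ∀ φ i ρ → trN φ i ρ → ¬ bN φ i ρ
  trN⇒¬bN (rel r ts) i ρ h ¬¬h = ¬¬h h
  trN⇒¬bN (eq t u)   i ρ h ¬¬h = ¬¬h h
  trN⇒¬bN (neg φ)    i ρ h     = h
  trN⇒¬bN (and φ ψ)  i ρ h     = h
  trN⇒¬bN (or φ ψ)   i ρ h     = h
  trN⇒¬bN (imp φ ψ)  i ρ h     = h
  trN⇒¬bN (all x θ)  i ρ h ¬h  = ¬h h
  trN⇒¬bN (ex x θ)   i ρ h ¬h  = ¬h h

  tr⇒bP : ∀ φ i ρ → tr φ i ρ → bP φ i ρ
  tr⇒bP (rel r ts) i ρ h = h
  tr⇒bP (eq t u)   i ρ h = h
  tr⇒bP (neg φ)    i ρ h = trN⇒¬bN φ i ρ h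
  tr⇒bP (and φ ψ)  i ρ h = h
  tr⇒bP (or φ ψ)   i ρ h = h
  tr⇒bP (imp φ ψ)  i ρ h = h
  tr⇒bP (all x θ)  i ρ h = h
  tr⇒bP (ex x θ)   i ρ h = h

  bP⇒bN : ∀ φ p q ρ → Fits (quantifierDepth φ) p → Fits (quantifierDepth φ) q → bP φ p ρ → bN φ q ρ
  bP⇒bN (rel r ts) p q ρ _ _ h ¬h = ¬h h
  bP⇒bN (eq t u)   p q ρ _ _ h ¬h = ¬h h
  bP⇒bN (neg φ)    p q ρ fp fq ¬bNφ bPφ = ¬bNφ (bP⇒bN φ q p ρ fq fp bPφ)
  bP⇒bN (and φ ψ)  p q ρ fp fq (hφ , hψ) =
    bP⇒bN φ p q ρ (Fits-⊔ˡ fp) (Fits-⊔ˡ fq) hφ , bP⇒bN ψ p q ρ (Fits-⊔ʳ fp) (Fits-⊔ʳ fq) hψ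
  bP⇒bN (or φ ψ)   p q ρ fp fq (inj₁ hφ) = inj₁ (bP⇒bN φ p q ρ (Fits-⊔ˡ fp) (Fits-⊔ˡ fq) hφ)
  bP⇒bN (or φ ψ)   p q ρ fp fq (inj₂ hψ) = inj₂ (bP⇒bN ψ p q ρ (Fits-⊔ʳ fp) (Fits-⊔ʳ fq) hψ)
  bP⇒bN (imp φ ψ)  p q ρ fp fq f hφ =
    bP⇒bN ψ p q ρ (Fits-⊔ʳ fp) (Fits-⊔ʳ fq) (f (bP⇒bN φ q p ρ (Fits-⊔ˡ fq) (Fits-⊔ˡ fp) hφ))
  bP⇒bN (all x θ)  p q ρ fp fq ∀θ (a , a∈A₊q , ¬θ)
    with j , p≤j , q<j , fj ← Fits-common-successor (quantifierDepth θ) p q fp fq =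
    trN⇒¬bN θ q _ ¬θ
      (bP⇒bN θ j q _ fj (Fits-suc⇒Fits fq) (tr⇒bP θ j _ (∀θ j p≤j a (A₊⊆A q<j a∈A₊q))))
  bP⇒bN (ex x θ)   p q ρ fp fq (a , a∈A₊p , θa) ∀¬θ
    with j , q≤j , p<j , fj ← Fits-common-successor (quantifierDepth θ) q p fq fp =
    trN⇒¬bN θ j _ (∀¬θ j q≤j a (A₊⊆A p<j a∈A₊p))
      (bP⇒bN θ p j _ (Fits-suc⇒Fits fp) fj (tr⇒bP θ p _ θa))

mainTheorem1 : (L : Language) (𝒜 : Structure L) (k : ℕ) (τ : Formula L) →
    HasRank k τ → (ρ : Env 𝒜) → ¬ Fulfillable 𝒜 (suc k) (and τ (neg τ)) ρ
mainTheorem1 L 𝒜 k τ rank ρ (σ , _ , (τ₀ , ¬τ₀) , increasing , _) =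
  ¬τ₀ (bP⇒bN 𝒜 σ increasing τ fzero fzero ρ τ-fits τ-fits τ₀)
  where
  τ-fits : Fits (quantifierDepth τ) fzero
  τ-fits = fits (s≤s (HasRank⇒quantifierDepth≤ rank))
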